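{- Let $p$ be an odd prime. Let $\mathcal{L}$ be the category whose objects are the groups $L(X)$ for countably infinite sets $X$, and whose morphisms $g\colon L(X)\to L(Y)$ are the surjective homomorphisms such that for each $v\in X$ the subgroup $\langle g(a_v)Z(L(Y)),\,g(b_v)Z(L(Y))\rangle$ of $L(Y)/Z(L(Y))$ has rank $2$. Then for every such morphism $g$ there is a unique map $F(g)\colon X\to Y$ such that for all $v\in X$, $\langle g(a_v)Z(L(Y)),\,g(b_v)Z(L(Y))\rangle=\langle a_{F(g)(v)}Z(L(Y)),\,b_{F(g)(v)}Z(L(Y))\rangle$; setting $F(L(X))=X$, this defines a functor $F$ from $\mathcal{L}$ to the category of countable sets with maps between them. Furthermore, if $q\colon X\to Y$ is a surjection, then $\widehat q$ is a morphism of $\mathcal{L}$ and $F(\widehat q)=q$.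
   Context: For a countably infinite set $X$, $N(X)$ is the free nilpotent group of class $2$ and exponent $p$ on distinct free generators $\{a_v,b_v:v\in X\}$, and $L(X)=N(X)/\langle\{[a_v,b_v]:v\in X\}\rangle$; $a_v,b_v$ also denote their images in $L(X)$. $Z(\cdot)$ denotes the centre; $L(Y)/Z(L(Y))$ is an $\mathbb{F}_p$-vector space and rank means dimension. For a surjection $q\colon X\to Y$, $\widehat q\colon L(X)\to L(Y)$ is the epimorphism sending $a_v\mapsto a_{q(v)}$ and $b_v\mapsto b_{q(v)}$. -}

module Defs where

open import Data.Nat using (ℕ; zero; suc)
open import Data.Nat.Divisibility using (_∣_)
open import Data.Product using (Σ; _×_; _,_; ∃)
open import Data.Empty using (⊥)
open import Function.Bundles using (_↔_)
open import Relation.Binary.PropositionalEquality using (_≡_)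

data Gen (X : Set) : Set where
  a : X → Gen X
  b : X → Gen X

mapGen : {X Y : Set} → (X → Y) → Gen X → Gen Y
mapGen q (a v) = a (q v)
mapGen q (b v) = b (q v)

infixl 7 _∙_
infix 8 _⁻¹

data Word (G : Set) : Set where
  gen : G → Word G
  e   : Word G
  _∙_ : Word G → Word G → Word G
  _⁻¹ : Word G → Word G

mapWord : {G H : Set} → (G → H) → Word G → Word H
mapWord f (gen x) = gen (f x)
mapWord f e = e
mapWord f (s ∙ t) = mapWord f s ∙ mapWord f t
mapWord f (s ⁻¹) = mapWord f s ⁻¹

module _ {G : Set} where

  infixr 9 _^_
  _^_ : Word G → ℕ → Word G
  x ^ zero = e
  x ^ suc n = x ∙ (x ^ n)

  [_,_] : Word G → Word G → Word G
  [ x , y ] = (x ⁻¹ ∙ y ⁻¹) ∙ (x ∙ y)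

-- With R empty this is the free nilpotent group of class 2 and exponent p
-- on G; with R the relators [a_v,b_v] it is the quotient L(X).

data Rel (p : ℕ) {G : Set} (R : Word G → Set) : Word G → Word G → Set where
  ≈refl  : ∀ {x} → Rel p R x x
  ≈sym   : ∀ {x y} → Rel p R x y → Rel p R y x
  ≈trans : ∀ {x y z} → Rel p R x y → Rel p R y z → Rel p R x z
  ∙-cong : ∀ {x x' y y'} → Rel p R x x' → Rel p R y y' → Rel p R (x ∙ y) (x' ∙ y')
  ⁻¹-cong : ∀ {x x'} → Rel p R x x' → Rel p R (x ⁻¹) (x' ⁻¹)
  assoc  : ∀ x y z → Rel p R ((x ∙ y) ∙ z) (x ∙ (y ∙ z))
  idˡ    : ∀ x → Rel p R (e ∙ x) x
  idʳ    : ∀ x → Rel p R (x ∙ e) x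
  invˡ   : ∀ x → Rel p R (x ⁻¹ ∙ x) e
  invʳ   : ∀ x → Rel p R (x ∙ x ⁻¹) e
  class2 : ∀ x y z → Rel p R [ [ x , y ] , z ] e
  expo   : ∀ x → Rel p R (x ^ p) e
  rel    : ∀ {r} → R r → Rel p R r e

NRel : (X : Set) → Word (Gen X) → Set
NRel X r = ⊥

-- L(X) = N(X) / < [a_v,b_v] : v ∈ X >  (normal closure; central anyway)
LRel : (X : Set) → Word (Gen X) → Set
LRel X r = ∃ λ v → r ≡ [ gen (a v) , gen (b v) ]

_≈L_ : {p : ℕ} {X : Set} → Word (Gen X) → Word (Gen X) → Set
_≈L_ {p} {X} = Rel p (LRel X)

record CInf : Set₁ where
  field
    Carrier : Set
    enum    : Carrier ↔ ℕ
open CInf public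

record Hom (p : ℕ) (X Y : Set) : Set where
  field
    fun     : Word (Gen X) → Word (Gen Y)
    fun-cong : ∀ {s t} → Rel p (LRel X) s t → Rel p (LRel Y) (fun s) (fun t)
    fun-hom  : ∀ s t → Rel p (LRel Y) (fun (s ∙ t)) (fun s ∙ fun t)
open Hom public

idH : (p : ℕ) (X : Set) → Hom p X X
idH p X = record { fun = λ s → s ; fun-cong = λ r → r ; fun-hom = λ s t → ≈refl }

_∘H_ : {p : ℕ} {X Y W : Set} → Hom p Y W → Hom p X Y → Hom p X W
_∘H_ h g = record
  { fun = λ s → fun h (fun g s)
  ; fun-cong = λ r → fun-cong h (fun-cong g r)
  ; fun-hom = λ s t → ≈trans (fun-cong h (fun-hom g s t)) (fun-hom h (fun g s) (fun g t))
  }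

qhatH : (p : ℕ) {X Y : Set} (q : X → Y) →
        (∀ {s t} → Rel p (LRel X) s t → Rel p (LRel Y) (mapWord (mapGen q) s) (mapWord (mapGen q) t)) →
        Hom p X Y
qhatH p q c = record { fun = mapWord (mapGen q) ; fun-cong = c ; fun-hom = λ s t → ≈refl }

Central : (p : ℕ) (Y : Set) → Word (Gen Y) → Set
Central p Y z = ∀ w → Rel p (LRel Y) (z ∙ w) (w ∙ z)

-- InSpanZ p Y x y : the preimage in L(Y) of the subgroup
-- < xZ , yZ > of L(Y)/Z(L(Y)), i.e. the subgroup generated by x, y, Z(L(Y)).
data InSpanZ (p : ℕ) (Y : Set) (x y : Word (Gen Y)) : Word (Gen Y) → Set where
  cent : ∀ {z} → Central p Y z → InSpanZ p Y x y z
  genx : InSpanZ p Y x y x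
  geny : InSpanZ p Y x y y
  mul  : ∀ {u w} → InSpanZ p Y x y u → InSpanZ p Y x y w → InSpanZ p Y x y (u ∙ w)
  inv  : ∀ {u} → InSpanZ p Y x y u → InSpanZ p Y x y (u ⁻¹)
  resp : ∀ {u w} → Rel p (LRel Y) u w → InSpanZ p Y x y u → InSpanZ p Y x y w

SameSpan : (p : ℕ) (Y : Set) → (x y x' y' : Word (Gen Y)) → Set
SameSpan p Y x y x' y' =
  ∀ z → (InSpanZ p Y x y z → InSpanZ p Y x' y' z) × (InSpanZ p Y x' y' z → InSpanZ p Y x y z)

-- <xZ,yZ> has rank 2 in the F_p-vector space L(Y)/Z(L(Y)):
-- xZ, yZ are F_p-linearly independent (x^i y^j ∈ Z only for i ≡ j ≡ 0 mod p).
RankTwo : (p : ℕ) (Y : Set) → (x y : Word (Gen Y)) → Set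
RankTwo p Y x y = ∀ i j → Central p Y (x ^ i ∙ y ^ j) → (p ∣ i) × (p ∣ j)

SurjectiveH : {p : ℕ} {X Y : Set} → Hom p X Y → Set
SurjectiveH {p} {X} {Y} g = ∀ t → ∃ λ s → Rel p (LRel Y) (fun g s) t

IsMorphism : {p : ℕ} {X Y : Set} → Hom p X Y → Set
IsMorphism {p} {X} {Y} g =
  SurjectiveH g × (∀ v → RankTwo p Y (fun g (gen (a v))) (fun g (gen (b v))))

Spec : {p : ℕ} {X Y : Set} → Hom p X Y → (X → Y) → Set
Spec {p} {X} {Y} g F = ∀ v →
  SameSpan p Y (fun g (gen (a v))) (fun g (gen (b v))) (gen (a (F v))) (gen (b (F v)))

Surjective : {X Y : Set} → (X → Y) → Set
Surjective q = ∀ y → ∃ λ x → q x ≡ y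

{-# OPTIONS --safe #-}

-- Modulo its centre, L(Y) is the 𝔽ₚ-vector space on the generators, the coordinate of a
-- generator g in a word being its exponent sum mod p: these sums respect the relations, a word
-- is central iff all of them vanish (collect it into a normal form modulo the centre), and the
-- subgroups ⟨xZ, yZ⟩ become spans of coordinate vectors.  On top of this there is a symplectic
-- structure: evaluating words in the Heisenberg group over 𝔽ₚ shows that when s and t commute,
-- every 2 × 2 minor of their coordinate vectors vanishes, except possibly those on a pair
-- (a y, b y).  The images g(a v), g(b v) commute because [a v, b v] = 1 and are independent by
-- hypothesis, so some such minor is non-zero; it forces all other coordinates to vanish, whence
-- ⟨g(a v)Z, g(b v)Z⟩ = ⟨a y Z, b y Z⟩.  The index y is unique because distinct pairs of
-- generators span distinct planes, and functoriality and F(q̂) = q follow from uniqueness.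
module Submission where

open import Defs

open import Algebra.Bundles using (Group; AbelianGroup)
import Algebra.Properties.CommutativeSemigroup as CommutativeSemigroupProperties
import Algebra.Properties.Group as GroupProperties
open import Data.Empty using (⊥-elim)
open import Data.Integer as ℤ using (ℤ; +_; 0ℤ; 1ℤ; _+_; _*_; _-_; -_)
open import Data.Integer.Divisibility.Signed using (_∣_; divides; _∣?_; ∣ᵤ⇒∣; ∣⇒∣ᵤ; ∣m∣n⇒∣m+n; ∣n⇒∣m*n)
open import Data.Integer.DivMod using (_%ℕ_; _/ℕ_; a≡a%ℕn+[a/ℕn]*n)
import Data.Integer.Properties as ℤ
open import Data.Integer.Tactic.RingSolver using (solve-∀)
open import Data.Nat as ℕ using (ℕ)
open import Data.Nat.Coprimality using (Coprime; coprime-Bézout)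
import Data.Nat.Divisibility as ℕ
open import Data.Nat.GCD using (module Bézout)
open import Data.Nat.Primality
  using (Prime; euclidsLemma; irreducible[2]; prime⇒irreducible; prime⇒nonZero; ¬prime[1])
import Data.Nat.Properties as ℕ
open import Data.Product as Product using (Σ; ∃; ∃₂; _×_; _,_; proj₁; proj₂)
open import Data.Sum as Sum using (_⊎_; inj₁; inj₂)
open import Function using (id; _∘_)
open import Function.Bundles using (_↔_; Inverse)
open import Function.Properties.Inverse using (↔⇒↣)
open import Level using (0ℓ)
open import Relation.Binary.Bundles using (Setoid)
open import Relation.Binary.Definitions using (DecidableEquality)
import Relation.Binary.Reasoning.Setoid as SetoidReasoning
open import Relation.Binary.Structures using (IsEquivalence)
open import Relation.Binary.PropositionalEquality
  using (_≡_; _≢_; refl; sym; trans; cong; cong₂; subst; subst₂; module ≡-Reasoning)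
open import Relation.Nullary using (¬_; Dec; yes; no)
import Relation.Nullary.Decidable as Dec

module Modular (p : ℕ) where

  infix 4 _≋_ _≉_

  record _≋_ (x y : ℤ) : Set where
    constructor mk≋
    field ∣-difference : + p ∣ x - y
  open _≋_ public

  _≉_ : ℤ → ℤ → Set
  x ≉ y = ¬ x ≋ y

  private
    ∣-resp : ∀ {x y} → x ≡ y → + p ∣ x → + p ∣ y
    ∣-resp = subst (+ p ∣_)

  ≡⇒≋ : ∀ {x y} → x ≡ y → x ≋ y
  ≡⇒≋ {x} refl = mk≋ (divides 0ℤ (ℤ.+-inverseʳ x))

  ≋-refl : ∀ {x} → x ≋ x
  ≋-refl = ≡⇒≋ refl

  ≋-sym : ∀ {x y} → x ≋ y → y ≋ x
  ≋-sym {x} {y} (mk≋ d) = mk≋ (∣-resp (swap x y) (∣n⇒∣m*n (- 1ℤ) d))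
    where swap : ∀ x y → - 1ℤ * (x - y) ≡ y - x
          swap = solve-∀

  ≋-trans : ∀ {x y z} → x ≋ y → y ≋ z → x ≋ z
  ≋-trans {x} {y} {z} (mk≋ d) (mk≋ d′) = mk≋ (∣-resp (telescope x y z) (∣m∣n⇒∣m+n d d′))
    where telescope : ∀ x y z → (x - y) + (y - z) ≡ x - z
          telescope = solve-∀

  ≋-isEquivalence : IsEquivalence _≋_
  ≋-isEquivalence = record { refl = ≋-refl ; sym = ≋-sym ; trans = ≋-trans }

  ≋-setoid : Setoid _ _
  ≋-setoid = record { isEquivalence = ≋-isEquivalence }

  +-cong : ∀ {x x′ y y′} → x ≋ x′ → y ≋ y′ → x + y ≋ x′ + y′
  +-cong {x} {x′} {y} {y′} (mk≋ d) (mk≋ d′) = mk≋ (∣-resp (split x x′ y y′) (∣m∣n⇒∣m+n d d′))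
    where split : ∀ x x′ y y′ → (x - x′) + (y - y′) ≡ (x + y) - (x′ + y′)
          split = solve-∀

  -‿cong : ∀ {x x′} → x ≋ x′ → - x ≋ - x′
  -‿cong {x} {x′} (mk≋ d) = mk≋ (∣-resp (split x x′) (∣n⇒∣m*n (- 1ℤ) d))
    where split : ∀ x x′ → - 1ℤ * (x - x′) ≡ - x - - x′
          split = solve-∀

  *-cong : ∀ {x x′ y y′} → x ≋ x′ → y ≋ y′ → x * y ≋ x′ * y′
  *-cong {x} {x′} {y} {y′} (mk≋ d) (mk≋ d′) =
    mk≋ (∣-resp (split x x′ y y′) (∣m∣n⇒∣m+n (∣n⇒∣m*n y d) (∣n⇒∣m*n x′ d′)))
    where split : ∀ x x′ y y′ → y * (x - x′) + x′ * (y - y′) ≡ x * y - x′ * y′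
          split = solve-∀

  multiple≋0 : ∀ k → + p * k ≋ 0ℤ
  multiple≋0 k = mk≋ (divides k (trans (ℤ.+-identityʳ (+ p * k)) (ℤ.*-comm (+ p) k)))

  ≋0⇒∣ : ∀ {x} → x ≋ 0ℤ → + p ∣ x
  ≋0⇒∣ {x} (mk≋ d) = ∣-resp (ℤ.+-identityʳ x) d

  ∣⇒≋0 : ∀ {x} → + p ∣ x → x ≋ 0ℤ
  ∣⇒≋0 {x} d = mk≋ (∣-resp (sym (ℤ.+-identityʳ x)) d)

  *0+*0≡0 : ∀ k l → k * 0ℤ + l * 0ℤ ≡ 0ℤ
  *0+*0≡0 = solve-∀

  lincomb-≋0 : ∀ {x y z} k l → x ≡ k * y + l * z → y ≋ 0ℤ → z ≋ 0ℤ → x ≋ 0ℤ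
  lincomb-≋0 k l refl y≋0 z≋0 =
    ≋-trans (+-cong (*-cong (≋-refl {k}) y≋0) (*-cong (≋-refl {l}) z≋0)) (≡⇒≋ (*0+*0≡0 k l))

  module ≋-Reasoning = SetoidReasoning ≋-setoid

module PrimeField {p : ℕ} (p-prime : Prime p) where

  open Modular p

  instance
    p-nonZero : ℕ.NonZero p
    p-nonZero = prime⇒nonZero p-prime

  _≋?_ : ∀ x y → Dec (x ≋ y)
  x ≋? y = Dec.map′ mk≋ ∣-difference (+ p ∣? x - y)

  +≋0⇒∣ : ∀ {n} → + n ≋ 0ℤ → p ℕ.∣ n
  +≋0⇒∣ n≋0 = ∣⇒∣ᵤ (≋0⇒∣ n≋0)

  ∣⇒+≋0 : ∀ {n} → p ℕ.∣ n → + n ≋ 0ℤ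
  ∣⇒+≋0 p∣n = ∣⇒≋0 (∣ᵤ⇒∣ p∣n)

  1≉0 : 1ℤ ≉ 0ℤ
  1≉0 1≋0 = ¬prime[1] (subst Prime (ℕ.∣1⇒≡1 (+≋0⇒∣ 1≋0)) p-prime)

  *≋0⇒≋0⊎≋0 : ∀ {x y} → x * y ≋ 0ℤ → x ≋ 0ℤ ⊎ y ≋ 0ℤ
  *≋0⇒≋0⊎≋0 {x} {y} xy≋0 =
    Sum.map (∣⇒≋0 ∘ ∣ᵤ⇒∣) (∣⇒≋0 ∘ ∣ᵤ⇒∣)
      (euclidsLemma ℤ.∣ x ∣ ℤ.∣ y ∣ p-prime (subst (p ℕ.∣_) (ℤ.abs-* x y) (∣⇒∣ᵤ (≋0⇒∣ xy≋0))))

  cancel-≉0 : ∀ {x y} → y ≉ 0ℤ → x * y ≋ 0ℤ → x ≋ 0ℤ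
  cancel-≉0 {x} {y} y≉0 xy≋0 = Sum.[ id , ⊥-elim ∘ y≉0 ]′ (*≋0⇒≋0⊎≋0 {x} {y} xy≋0)

  cramer : ∀ {α β γ δ i j} → α * δ - β * γ ≉ 0ℤ →
           i * α + j * γ ≋ 0ℤ → i * β + j * δ ≋ 0ℤ → i ≋ 0ℤ × j ≋ 0ℤ
  cramer {α} {β} {γ} {δ} {i} {j} det≉0 eq₁ eq₂ =
    cancel-≉0 {i} det≉0 (lincomb-≋0 δ (- γ) (eliminateʲ α β γ δ i j) eq₁ eq₂) ,
    cancel-≉0 {j} det≉0 (lincomb-≋0 α (- β) (eliminateⁱ α β γ δ i j) eq₂ eq₁)
    where
    eliminateʲ : ∀ α β γ δ i j →
      i * (α * δ - β * γ) ≡ δ * (i * α + j * γ) + (- γ) * (i * β + j * δ)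
    eliminateʲ = solve-∀
    eliminateⁱ : ∀ α β γ δ i j →
      j * (α * δ - β * γ) ≡ α * (i * β + j * δ) + (- β) * (i * α + j * γ)
    eliminateⁱ = solve-∀

  private
    coprime : ∀ {n} → ¬ p ℕ.∣ n → Coprime n p
    coprime p∤n (d∣n , d∣p) with prime⇒irreducible p-prime d∣p
    ... | inj₁ d≡1 = d≡1
    ... | inj₂ refl = ⊥-elim (p∤n d∣n)

    lift-Bézout : ∀ {i j k l} → 1 ℕ.+ i ℕ.* j ≡ k ℕ.* l → 1ℤ + + i * + j ≡ + k * + l
    lift-Bézout {i} {j} {k} {l} eq = begin
      1ℤ + + i * + j     ≡⟨ cong (_+_ 1ℤ) (ℤ.pos-* i j) ⟨
      + (1 ℕ.+ i ℕ.* j)  ≡⟨ cong +_ eq ⟩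
      + (k ℕ.* l)        ≡⟨ ℤ.pos-* k l ⟩
      + k * + l          ∎
      where open ≡-Reasoning

    invertibleℕ : ∀ {n} → ¬ p ℕ.∣ n → ∃ λ y → + n * y ≋ 1ℤ
    invertibleℕ {n} p∤n with coprime-Bézout (coprime p∤n)
    ... | Bézout.+- u v eq = + u , mk≋ (divides (+ v) (begin
      + n * + u - 1ℤ        ≡⟨ cong (λ t → t - 1ℤ) (ℤ.*-comm (+ n) (+ u)) ⟩
      + u * + n - 1ℤ        ≡⟨ cong (λ t → t - 1ℤ) (lift-Bézout {v} {p} {u} {n} eq) ⟨
      1ℤ + + v * + p - 1ℤ   ≡⟨ cancel (+ v * + p) ⟩
      + v * + p             ∎))
      where open ≡-Reasoning
            cancel : ∀ a → 1ℤ + a - 1ℤ ≡ a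
            cancel = solve-∀
    ... | Bézout.-+ u v eq = - + u , mk≋ (divides (- + v) (begin
      + n * - + u - 1ℤ      ≡⟨ negate (+ n) (+ u) ⟩
      - (1ℤ + + u * + n)    ≡⟨ cong -_ (lift-Bézout {u} {n} {v} {p} eq) ⟩
      - (+ v * + p)         ≡⟨ ℤ.neg-distribˡ-* (+ v) (+ p) ⟩
      - + v * + p           ∎))
      where open ≡-Reasoning
            negate : ∀ n u → n * - u - 1ℤ ≡ - (1ℤ + u * n)
            negate = solve-∀

  ≉0⇒invertible : ∀ {x} → x ≉ 0ℤ → ∃ λ y → x * y ≋ 1ℤ
  ≉0⇒invertible {x} x≉0 with invertibleℕ (x≉0 ∘ ∣⇒≋0 ∘ ∣ᵤ⇒∣) | ℤ.+∣i∣≡i⊎+∣i∣≡-i x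
  ... | y , ∣x∣y≋1 | inj₁ ∣x∣≡x  = y , subst (λ t → t * y ≋ 1ℤ) ∣x∣≡x ∣x∣y≋1
  ... | y , ∣x∣y≋1 | inj₂ ∣x∣≡-x = - y , ≋-trans (≡⇒≋ (flip x y)) (subst (λ t → t * y ≋ 1ℤ) ∣x∣≡-x ∣x∣y≋1)
    where flip : ∀ x y → x * - y ≡ - x * y
          flip = solve-∀

  2≉0 : p ≢ 2 → + 2 ≉ 0ℤ
  2≉0 p≢2 2≋0 = Sum.[ (λ p≡1 → ¬prime[1] (subst Prime p≡1 p-prime)) , p≢2 ]′ (irreducible[2] (+≋0⇒∣ 2≋0))

  half : p ≢ 2 → ∃ λ ½ → ½ + ½ ≋ 1ℤ
  half p≢2 with ≉0⇒invertible (2≉0 p≢2)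
  ... | ½ , 2*½≋1 = ½ , ≋-trans (≡⇒≋ (double ½)) 2*½≋1
    where double : ∀ h → h + h ≡ + 2 * h
          double = solve-∀

  pred-p≋-1 : + ℕ.pred p ≋ - 1ℤ
  pred-p≋-1 = mk≋ (divides 1ℤ (begin
    + ℕ.pred p - - 1ℤ     ≡⟨ shift (+ ℕ.pred p) ⟩
    + ℕ.suc (ℕ.pred p)    ≡⟨ cong +_ (ℕ.suc-pred p) ⟩
    + p                   ≡⟨ ℤ.*-identityˡ (+ p) ⟨
    1ℤ * + p              ∎))
    where open ≡-Reasoning
          shift : ∀ n → n - - 1ℤ ≡ 1ℤ + n
          shift = solve-∀

  residue : ℤ → ℕ
  residue x = x %ℕ p

  +residue≋ : ∀ x → + residue x ≋ x
  +residue≋ x = ≋-sym (mk≋ (divides (x /ℕ p) (begin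
    x - + residue x                             ≡⟨ cong (λ t → t - + residue x) (a≡a%ℕn+[a/ℕn]*n x p) ⟩
    + residue x + (x /ℕ p) * + p - + residue x  ≡⟨ cancel (+ residue x) ((x /ℕ p) * + p) ⟩
    (x /ℕ p) * + p                              ∎)))
    where open ≡-Reasoning
          cancel : ∀ r q → r + q - r ≡ q
          cancel = solve-∀

exponentSum : {G : Set} → (G → ℤ) → Word G → ℤ
exponentSum f (gen x) = f x
exponentSum f e       = 0ℤ
exponentSum f (s ∙ t) = exponentSum f s + exponentSum f t
exponentSum f (s ⁻¹)  = - exponentSum f s

exponentSum-^ : ∀ {G} (f : G → ℤ) x n → exponentSum f (x ^ n) ≡ + n * exponentSum f x
exponentSum-^ f x ℕ.zero    = refl
exponentSum-^ f x (ℕ.suc n) =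
  trans (cong (_+_ (exponentSum f x)) (exponentSum-^ f x n)) (distrib (exponentSum f x) (+ n))
  where distrib : ∀ a k → a + k * a ≡ (1ℤ + k) * a
        distrib = solve-∀

module Heisenberg (p : ℕ) (½ : ℤ) (½+½≋1 : Modular._≋_ p (½ + ½) 1ℤ) where

  open Modular p

  -- The Heisenberg group over 𝔽ₚ in symmetric form, with cocycle ½ ω.  As ω is alternating,
  -- the group laws hold exactly in ℤ, powers are scalar multiples (so the exponent is p), and
  -- commutators are ⟨ 0 , 0 , ω ⟩ modulo p.
  record H : Set where
    constructor ⟨_,_,_⟩
    field h₁ h₂ h₃ : ℤ
  open H public

  ω : H → H → ℤ
  ω x y = h₁ x * h₂ y - h₂ x * h₁ y

  infixl 7 _·_
  infix 8 _⁻¹ᴴ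

  _·_ : H → H → H
  x · y = ⟨ h₁ x + h₁ y , h₂ x + h₂ y , h₃ x + h₃ y + ½ * ω x y ⟩

  _⁻¹ᴴ : H → H
  x ⁻¹ᴴ = ⟨ - h₁ x , - h₂ x , - h₃ x ⟩

  εᴴ : H
  εᴴ = ⟨ 0ℤ , 0ℤ , 0ℤ ⟩

  [_,_]ᴴ : H → H → H
  [ x , y ]ᴴ = (x ⁻¹ᴴ · y ⁻¹ᴴ) · (x · y)

  _•_ : ℤ → H → H
  k • x = ⟨ k * h₁ x , k * h₂ x , k * h₃ x ⟩

  infix 4 _≋ᴴ_

  record _≋ᴴ_ (x y : H) : Set where
    constructor mk≋ᴴ
    field
      ≋₁ : h₁ x ≋ h₁ y
      ≋₂ : h₂ x ≋ h₂ y
      ≋₃ : h₃ x ≋ h₃ y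
  open _≋ᴴ_ public

  exactly : ∀ {x y} → h₁ x ≡ h₁ y → h₂ x ≡ h₂ y → h₃ x ≡ h₃ y → x ≋ᴴ y
  exactly e₁ e₂ e₃ = mk≋ᴴ (≡⇒≋ e₁) (≡⇒≋ e₂) (≡⇒≋ e₃)

  ≋ᴴ-refl : ∀ {x} → x ≋ᴴ x
  ≋ᴴ-refl = exactly refl refl refl

  ≋ᴴ-sym : ∀ {x y} → x ≋ᴴ y → y ≋ᴴ x
  ≋ᴴ-sym (mk≋ᴴ e₁ e₂ e₃) = mk≋ᴴ (≋-sym e₁) (≋-sym e₂) (≋-sym e₃)

  ≋ᴴ-trans : ∀ {x y z} → x ≋ᴴ y → y ≋ᴴ z → x ≋ᴴ z
  ≋ᴴ-trans (mk≋ᴴ e₁ e₂ e₃) (mk≋ᴴ f₁ f₂ f₃) = mk≋ᴴ (≋-trans e₁ f₁) (≋-trans e₂ f₂) (≋-trans e₃ f₃)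

  ω-cong : ∀ {x x′ y y′} → x ≋ᴴ x′ → y ≋ᴴ y′ → ω x y ≋ ω x′ y′
  ω-cong (mk≋ᴴ e₁ e₂ _) (mk≋ᴴ f₁ f₂ _) = +-cong (*-cong e₁ f₂) (-‿cong (*-cong e₂ f₁))

  ·-cong : ∀ {x x′ y y′} → x ≋ᴴ x′ → y ≋ᴴ y′ → x · y ≋ᴴ x′ · y′
  ·-cong ex@(mk≋ᴴ e₁ e₂ e₃) ey@(mk≋ᴴ f₁ f₂ f₃) =
    mk≋ᴴ (+-cong e₁ f₁) (+-cong e₂ f₂) (+-cong (+-cong e₃ f₃) (*-cong (≋-refl {½}) (ω-cong ex ey)))

  ⁻¹ᴴ-cong : ∀ {x x′} → x ≋ᴴ x′ → x ⁻¹ᴴ ≋ᴴ x′ ⁻¹ᴴ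
  ⁻¹ᴴ-cong (mk≋ᴴ e₁ e₂ e₃) = mk≋ᴴ (-‿cong e₁) (-‿cong e₂) (-‿cong e₃)

  [,]ᴴ-cong : ∀ {x x′ y y′} → x ≋ᴴ x′ → y ≋ᴴ y′ → [ x , y ]ᴴ ≋ᴴ [ x′ , y′ ]ᴴ
  [,]ᴴ-cong ex ey = ·-cong (·-cong (⁻¹ᴴ-cong ex) (⁻¹ᴴ-cong ey)) (·-cong ex ey)

  ·-assoc : ∀ x y z → (x · y) · z ≋ᴴ x · (y · z)
  ·-assoc ⟨ x₁ , x₂ , x₃ ⟩ ⟨ y₁ , y₂ , y₃ ⟩ ⟨ z₁ , z₂ , z₃ ⟩ =
    exactly (ℤ.+-assoc x₁ y₁ z₁) (ℤ.+-assoc x₂ y₂ z₂) (assoc₃ ½ x₁ x₂ x₃ y₁ y₂ y₃ z₁ z₂ z₃)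
    where
    assoc₃ : ∀ h x₁ x₂ x₃ y₁ y₂ y₃ z₁ z₂ z₃ →
      x₃ + y₃ + h * (x₁ * y₂ - x₂ * y₁) + z₃ + h * ((x₁ + y₁) * z₂ - (x₂ + y₂) * z₁) ≡
      x₃ + (y₃ + z₃ + h * (y₁ * z₂ - y₂ * z₁)) + h * (x₁ * (y₂ + z₂) - x₂ * (y₁ + z₁))
    assoc₃ = solve-∀

  ·-identityˡ : ∀ x → εᴴ · x ≋ᴴ x
  ·-identityˡ ⟨ x₁ , x₂ , x₃ ⟩ = exactly (ℤ.+-identityˡ x₁) (ℤ.+-identityˡ x₂) (identityˡ₃ ½ x₁ x₂ x₃)
    where
    identityˡ₃ : ∀ h x₁ x₂ x₃ → 0ℤ + x₃ + h * (0ℤ * x₂ - 0ℤ * x₁) ≡ x₃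
    identityˡ₃ = solve-∀

  ·-identityʳ : ∀ x → x · εᴴ ≋ᴴ x
  ·-identityʳ ⟨ x₁ , x₂ , x₃ ⟩ = exactly (ℤ.+-identityʳ x₁) (ℤ.+-identityʳ x₂) (identityʳ₃ ½ x₁ x₂ x₃)
    where
    identityʳ₃ : ∀ h x₁ x₂ x₃ → x₃ + 0ℤ + h * (x₁ * 0ℤ - x₂ * 0ℤ) ≡ x₃
    identityʳ₃ = solve-∀

  ·-inverseˡ : ∀ x → x ⁻¹ᴴ · x ≋ᴴ εᴴ
  ·-inverseˡ ⟨ x₁ , x₂ , x₃ ⟩ = exactly (ℤ.+-inverseˡ x₁) (ℤ.+-inverseˡ x₂) (inverseˡ₃ ½ x₁ x₂ x₃)
    where
    inverseˡ₃ : ∀ h x₁ x₂ x₃ → - x₃ + x₃ + h * (- x₁ * x₂ - - x₂ * x₁) ≡ 0ℤ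
    inverseˡ₃ = solve-∀

  ·-inverseʳ : ∀ x → x · x ⁻¹ᴴ ≋ᴴ εᴴ
  ·-inverseʳ ⟨ x₁ , x₂ , x₃ ⟩ = exactly (ℤ.+-inverseʳ x₁) (ℤ.+-inverseʳ x₂) (inverseʳ₃ ½ x₁ x₂ x₃)
    where
    inverseʳ₃ : ∀ h x₁ x₂ x₃ → x₃ + - x₃ + h * (x₁ * - x₂ - x₂ * - x₁) ≡ 0ℤ
    inverseʳ₃ = solve-∀

  [,]ᴴ≋ω : ∀ x y → [ x , y ]ᴴ ≋ᴴ ⟨ 0ℤ , 0ℤ , ω x y ⟩
  [,]ᴴ≋ω ⟨ x₁ , x₂ , x₃ ⟩ ⟨ y₁ , y₂ , y₃ ⟩ =
    mk≋ᴴ (≡⇒≋ (cancel x₁ y₁)) (≡⇒≋ (cancel x₂ y₂))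
         (≋-trans (≡⇒≋ (commutator₃ ½ x₁ x₂ x₃ y₁ y₂ y₃))
                  (≋-trans (*-cong ½+½≋1 ≋-refl) (≡⇒≋ (ℤ.*-identityˡ (x₁ * y₂ - x₂ * y₁)))))
    where
    cancel : ∀ x y → - x + - y + (x + y) ≡ 0ℤ
    cancel = solve-∀
    commutator₃ : ∀ h x₁ x₂ x₃ y₁ y₂ y₃ →
      - x₃ + - y₃ + h * (- x₁ * - y₂ - - x₂ * - y₁) + (x₃ + y₃ + h * (x₁ * y₂ - x₂ * y₁))
        + h * ((- x₁ + - y₁) * (x₂ + y₂) - (- x₂ + - y₂) * (x₁ + y₁))
      ≡ (h + h) * (x₁ * y₂ - x₂ * y₁)
    commutator₃ = solve-∀

  class₂ᴴ : ∀ x y z → [ [ x , y ]ᴴ , z ]ᴴ ≋ᴴ εᴴ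
  class₂ᴴ x y z@(⟨ z₁ , z₂ , _ ⟩) =
    ≋ᴴ-trans ([,]ᴴ-cong ([,]ᴴ≋ω x y) (≋ᴴ-refl {z}))
             (≋ᴴ-trans ([,]ᴴ≋ω ⟨ 0ℤ , 0ℤ , ω x y ⟩ z) (exactly refl refl (vanish z₁ z₂)))
    where
    vanish : ∀ z₁ z₂ → 0ℤ * z₂ - 0ℤ * z₁ ≡ 0ℤ
    vanish = solve-∀

  x·k•x≋[1+k]•x : ∀ k x → x · (k • x) ≋ᴴ (1ℤ + k) • x
  x·k•x≋[1+k]•x k ⟨ x₁ , x₂ , x₃ ⟩ = exactly (distrib x₁ k) (distrib x₂ k) (distrib₃ ½ k x₁ x₂ x₃)
    where
    distrib : ∀ a k → a + k * a ≡ (1ℤ + k) * a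
    distrib = solve-∀
    distrib₃ : ∀ h k x₁ x₂ x₃ → x₃ + k * x₃ + h * (x₁ * (k * x₂) - x₂ * (k * x₁)) ≡ (1ℤ + k) * x₃
    distrib₃ = solve-∀

  p•≋εᴴ : ∀ x → (+ p) • x ≋ᴴ εᴴ
  p•≋εᴴ x = mk≋ᴴ (multiple≋0 (h₁ x)) (multiple≋0 (h₂ x)) (multiple≋0 (h₃ x))

  commute⇒ω≋0 : ∀ {x y} → x · y ≋ᴴ y · x → ω x y ≋ 0ℤ
  commute⇒ω≋0 {x@(⟨ x₁ , x₂ , x₃ ⟩)} {y@(⟨ y₁ , y₂ , y₃ ⟩)} (mk≋ᴴ _ _ (mk≋ d)) = begin
    ω x y             ≈⟨ ≡⇒≋ (ℤ.*-identityˡ (ω x y)) ⟨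
    1ℤ * ω x y        ≈⟨ *-cong ½+½≋1 ≋-refl ⟨
    (½ + ½) * ω x y   ≈⟨ ∣⇒≋0 (subst (+ p ∣_) (difference ½ x₁ x₂ x₃ y₁ y₂ y₃) d) ⟩
    0ℤ                ∎
    where
    open ≋-Reasoning
    difference : ∀ h x₁ x₂ x₃ y₁ y₂ y₃ →
      x₃ + y₃ + h * (x₁ * y₂ - x₂ * y₁) - (y₃ + x₃ + h * (y₁ * x₂ - y₂ * x₁))
        ≡ (h + h) * (x₁ * y₂ - x₂ * y₁)
    difference = solve-∀

  module Evaluation {G : Set} (σ : G → H) where

    ⟦_⟧ : Word G → H
    ⟦ gen x ⟧ = σ x
    ⟦ e ⟧     = εᴴ
    ⟦ s ∙ t ⟧ = ⟦ s ⟧ · ⟦ t ⟧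
    ⟦ s ⁻¹ ⟧  = ⟦ s ⟧ ⁻¹ᴴ

    ⟦^⟧ : ∀ x n → ⟦ x ^ n ⟧ ≋ᴴ (+ n) • ⟦ x ⟧
    ⟦^⟧ x ℕ.zero    = ≋ᴴ-refl
    ⟦^⟧ x (ℕ.suc n) = ≋ᴴ-trans (·-cong (≋ᴴ-refl {⟦ x ⟧}) (⟦^⟧ x n)) (x·k•x≋[1+k]•x (+ n) ⟦ x ⟧)

    module _ {R : Word G → Set} (kills : ∀ {r} → R r → ⟦ r ⟧ ≋ᴴ εᴴ) where

      ⟦⟧-cong : ∀ {s t} → Rel p R s t → ⟦ s ⟧ ≋ᴴ ⟦ t ⟧
      ⟦⟧-cong ≈refl           = ≋ᴴ-refl
      ⟦⟧-cong (≈sym r)        = ≋ᴴ-sym (⟦⟧-cong r)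
      ⟦⟧-cong (≈trans r r′)   = ≋ᴴ-trans (⟦⟧-cong r) (⟦⟧-cong r′)
      ⟦⟧-cong (∙-cong r r′)   = ·-cong (⟦⟧-cong r) (⟦⟧-cong r′)
      ⟦⟧-cong (⁻¹-cong r)     = ⁻¹ᴴ-cong (⟦⟧-cong r)
      ⟦⟧-cong (assoc x y z)   = ·-assoc ⟦ x ⟧ ⟦ y ⟧ ⟦ z ⟧
      ⟦⟧-cong (idˡ x)         = ·-identityˡ ⟦ x ⟧
      ⟦⟧-cong (idʳ x)         = ·-identityʳ ⟦ x ⟧
      ⟦⟧-cong (invˡ x)        = ·-inverseˡ ⟦ x ⟧
      ⟦⟧-cong (invʳ x)        = ·-inverseʳ ⟦ x ⟧
      ⟦⟧-cong (class2 x y z)  = class₂ᴴ ⟦ x ⟧ ⟦ y ⟧ ⟦ z ⟧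
      ⟦⟧-cong (expo x)        = ≋ᴴ-trans (⟦^⟧ x p) (p•≋εᴴ ⟦ x ⟧)
      ⟦⟧-cong (rel r)         = kills r

      commute⇒ω⟦⟧≋0 : ∀ {s t} → Rel p R (s ∙ t) (t ∙ s) → ω ⟦ s ⟧ ⟦ t ⟧ ≋ 0ℤ
      commute⇒ω⟦⟧≋0 {s} {t} st≈ts = commute⇒ω≋0 {⟦ s ⟧} {⟦ t ⟧} (⟦⟧-cong st≈ts)

    h₁-⟦⟧ : ∀ w → h₁ ⟦ w ⟧ ≡ exponentSum (h₁ ∘ σ) w
    h₁-⟦⟧ (gen x) = refl
    h₁-⟦⟧ e       = refl
    h₁-⟦⟧ (s ∙ t) = cong₂ _+_ (h₁-⟦⟧ s) (h₁-⟦⟧ t)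
    h₁-⟦⟧ (s ⁻¹)  = cong -_ (h₁-⟦⟧ s)

    h₂-⟦⟧ : ∀ w → h₂ ⟦ w ⟧ ≡ exponentSum (h₂ ∘ σ) w
    h₂-⟦⟧ (gen x) = refl
    h₂-⟦⟧ e       = refl
    h₂-⟦⟧ (s ∙ t) = cong₂ _+_ (h₂-⟦⟧ s) (h₂-⟦⟧ t)
    h₂-⟦⟧ (s ⁻¹)  = cong -_ (h₂-⟦⟧ s)

module WordGroup (p : ℕ) {G : Set} (R : Word G → Set) where

  infix 4 _≈_ _~_

  _≈_ : Word G → Word G → Set
  _≈_ = Rel p R

  group : Group 0ℓ 0ℓ
  group = record
    { Carrier = Word G ; _≈_ = _≈_ ; _∙_ = _∙_ ; ε = e ; _⁻¹ = _⁻¹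
    ; isGroup = record
      { isMonoid = record
        { isSemigroup = record
          { isMagma = record
            { isEquivalence = record { refl = ≈refl ; sym = ≈sym ; trans = ≈trans }
            ; ∙-cong = ∙-cong }
          ; assoc = assoc }
        ; identity = idˡ , idʳ }
      ; inverse = invˡ , invʳ
      ; ⁻¹-cong = ⁻¹-cong } }

  open Group group public using (setoid; ∙-congˡ; ∙-congʳ)
  open GroupProperties group public
    using (ε⁻¹≈ε; ⁻¹-involutive; ⁻¹-anti-homo-∙; inverseʳ-unique; identityʳ-unique;
           x≈y⇒x∙y⁻¹≈ε; \\-leftDividesʳ; //-rightDividesˡ)
  open SetoidReasoning setoid

  ^-+ : ∀ x m n → x ^ (m ℕ.+ n) ≈ x ^ m ∙ x ^ n
  ^-+ x ℕ.zero    n = ≈sym (idˡ (x ^ n))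
  ^-+ x (ℕ.suc m) n = ≈trans (∙-congˡ (^-+ x m n)) (≈sym (assoc x (x ^ m) (x ^ n)))

  ^-*p : ∀ x q → x ^ (q ℕ.* p) ≈ e
  ^-*p x ℕ.zero    = ≈refl
  ^-*p x (ℕ.suc q) = ≈trans (^-+ x p (q ℕ.* p)) (≈trans (∙-cong (expo x) (^-*p x q)) (idˡ e))

  ∣⇒^≈e : ∀ x {n} → p ℕ.∣ n → x ^ n ≈ e
  ∣⇒^≈e x (ℕ.divides q refl) = ^-*p x q

  [,]≈e⇒commute : ∀ {x y} → [ x , y ] ≈ e → x ∙ y ≈ y ∙ x
  [,]≈e⇒commute {x} {y} [x,y]≈e = begin
    x ∙ y                ≈⟨ inverseʳ-unique (x ⁻¹ ∙ y ⁻¹) (x ∙ y) [x,y]≈e ⟩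
    (x ⁻¹ ∙ y ⁻¹) ⁻¹     ≈⟨ ⁻¹-cong (⁻¹-anti-homo-∙ y x) ⟨
    (y ∙ x) ⁻¹ ⁻¹        ≈⟨ ⁻¹-involutive (y ∙ x) ⟩
    y ∙ x                ∎

  IsCentral : Word G → Set
  IsCentral z = ∀ w → z ∙ w ≈ w ∙ z

  central-resp : ∀ {x y} → x ≈ y → IsCentral x → IsCentral y
  central-resp x≈y x-central w = ≈trans (∙-congʳ (≈sym x≈y)) (≈trans (x-central w) (∙-congˡ x≈y))

  e-central : IsCentral e
  e-central w = ≈trans (idˡ w) (≈sym (idʳ w))

  ∙-central : ∀ {x y} → IsCentral x → IsCentral y → IsCentral (x ∙ y)
  ∙-central {x} {y} x-central y-central w = begin
    (x ∙ y) ∙ w  ≈⟨ assoc x y w ⟩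
    x ∙ (y ∙ w)  ≈⟨ ∙-congˡ (y-central w) ⟩
    x ∙ (w ∙ y)  ≈⟨ assoc x w y ⟨
    (x ∙ w) ∙ y  ≈⟨ ∙-congʳ (x-central w) ⟩
    (w ∙ x) ∙ y  ≈⟨ assoc w x y ⟩
    w ∙ (x ∙ y)  ∎

  ⁻¹-central : ∀ {x} → IsCentral x → IsCentral (x ⁻¹)
  ⁻¹-central {x} x-central w = begin
    x ⁻¹ ∙ w            ≈⟨ ∙-congˡ (⁻¹-involutive w) ⟨
    x ⁻¹ ∙ w ⁻¹ ⁻¹      ≈⟨ ⁻¹-anti-homo-∙ (w ⁻¹) x ⟨
    (w ⁻¹ ∙ x) ⁻¹       ≈⟨ ⁻¹-cong (x-central (w ⁻¹)) ⟨
    (x ∙ w ⁻¹) ⁻¹       ≈⟨ ⁻¹-anti-homo-∙ x (w ⁻¹) ⟩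
    w ⁻¹ ⁻¹ ∙ x ⁻¹      ≈⟨ ∙-congʳ (⁻¹-involutive w) ⟩
    w ∙ x ⁻¹            ∎

  [,]-central : ∀ x y → IsCentral [ x , y ]
  [,]-central x y z = [,]≈e⇒commute (class2 x y z)

  _~_ : Word G → Word G → Set
  x ~ y = IsCentral (x ∙ y ⁻¹)

  ≈⇒~ : ∀ {x y} → x ≈ y → x ~ y
  ≈⇒~ x≈y = central-resp (≈sym (x≈y⇒x∙y⁻¹≈ε x≈y)) e-central

  ~-sym : ∀ {x y} → x ~ y → y ~ x
  ~-sym {x} {y} x~y = central-resp inverse (⁻¹-central x~y)
    where
    inverse : (x ∙ y ⁻¹) ⁻¹ ≈ y ∙ x ⁻¹
    inverse = ≈trans (⁻¹-anti-homo-∙ x (y ⁻¹)) (∙-congʳ (⁻¹-involutive y))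

  ~-trans : ∀ {x y z} → x ~ y → y ~ z → x ~ z
  ~-trans {x} {y} {z} x~y y~z = central-resp telescope (∙-central x~y y~z)
    where
    telescope : (x ∙ y ⁻¹) ∙ (y ∙ z ⁻¹) ≈ x ∙ z ⁻¹
    telescope = ≈trans (assoc x (y ⁻¹) (y ∙ z ⁻¹)) (∙-congˡ (\\-leftDividesʳ y (z ⁻¹)))

  ∙-cong~ : ∀ {x x′ y y′} → x ~ x′ → y ~ y′ → x ∙ y ~ x′ ∙ y′
  ∙-cong~ {x} {x′} {y} {y′} x~x′ y~y′ = central-resp (≈sym regroup) (∙-central x~x′ y~y′)
    where
    regroup : (x ∙ y) ∙ (x′ ∙ y′) ⁻¹ ≈ (x ∙ x′ ⁻¹) ∙ (y ∙ y′ ⁻¹)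
    regroup = begin
      (x ∙ y) ∙ (x′ ∙ y′) ⁻¹         ≈⟨ ∙-congˡ (⁻¹-anti-homo-∙ x′ y′) ⟩
      (x ∙ y) ∙ (y′ ⁻¹ ∙ x′ ⁻¹)      ≈⟨ assoc x y _ ⟩
      x ∙ (y ∙ (y′ ⁻¹ ∙ x′ ⁻¹))      ≈⟨ ∙-congˡ (assoc y (y′ ⁻¹) (x′ ⁻¹)) ⟨
      x ∙ ((y ∙ y′ ⁻¹) ∙ x′ ⁻¹)      ≈⟨ ∙-congˡ (y~y′ (x′ ⁻¹)) ⟩
      x ∙ (x′ ⁻¹ ∙ (y ∙ y′ ⁻¹))      ≈⟨ assoc x (x′ ⁻¹) _ ⟨
      (x ∙ x′ ⁻¹) ∙ (y ∙ y′ ⁻¹)      ∎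

  ⁻¹-cong~ : ∀ {x x′} → x ~ x′ → x ⁻¹ ~ x′ ⁻¹
  ⁻¹-cong~ {x} {x′} x~x′ = central-resp inverse (⁻¹-central (central-resp conjugate x~x′))
    where
    conjugate : x ∙ x′ ⁻¹ ≈ x′ ⁻¹ ∙ x
    conjugate = begin
      x ∙ x′ ⁻¹                  ≈⟨ \\-leftDividesʳ x′ (x ∙ x′ ⁻¹) ⟨
      x′ ⁻¹ ∙ (x′ ∙ (x ∙ x′ ⁻¹))  ≈⟨ ∙-congˡ (x~x′ x′) ⟨
      x′ ⁻¹ ∙ ((x ∙ x′ ⁻¹) ∙ x′)  ≈⟨ ∙-congˡ (//-rightDividesˡ x′ x) ⟩
      x′ ⁻¹ ∙ x                  ∎
    inverse : (x′ ⁻¹ ∙ x) ⁻¹ ≈ x ⁻¹ ∙ x′ ⁻¹ ⁻¹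
    inverse = ⁻¹-anti-homo-∙ (x′ ⁻¹) x

  ~-comm : ∀ x y → x ∙ y ~ y ∙ x
  ~-comm x y = central-resp commutator ([,]-central (x ⁻¹) (y ⁻¹))
    where
    commutator : [ x ⁻¹ , y ⁻¹ ] ≈ (x ∙ y) ∙ (y ∙ x) ⁻¹
    commutator = ∙-cong (∙-cong (⁻¹-involutive x) (⁻¹-involutive y)) (≈sym (⁻¹-anti-homo-∙ y x))

  centralQuotient : AbelianGroup 0ℓ 0ℓ
  centralQuotient = record
    { Carrier = Word G ; _≈_ = _~_ ; _∙_ = _∙_ ; ε = e ; _⁻¹ = _⁻¹
    ; isAbelianGroup = record
      { isGroup = record
        { isMonoid = record
          { isSemigroup = record
            { isMagma = record
              { isEquivalence = record { refl = ≈⇒~ ≈refl ; sym = ~-sym ; trans = ~-trans }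
              ; ∙-cong = ∙-cong~ }
            ; assoc = λ x y z → ≈⇒~ (assoc x y z) }
          ; identity = (λ x → ≈⇒~ (idˡ x)) , (λ x → ≈⇒~ (idʳ x)) }
        ; inverse = (λ x → ≈⇒~ (invˡ x)) , (λ x → ≈⇒~ (invʳ x))
        ; ⁻¹-cong = ⁻¹-cong~ }
      ; comm = ~-comm } }

module Spans {p : ℕ} {Y : Set} where

  open WordGroup p (LRel Y)

  span-^ : ∀ {x y z} n → InSpanZ p Y x y z → InSpanZ p Y x y (z ^ n)
  span-^ ℕ.zero    _   = cent e-central
  span-^ (ℕ.suc n) z∈ = mul z∈ (span-^ n z∈)

  span-⊆ : ∀ {x y x′ y′ z} → InSpanZ p Y x′ y′ x → InSpanZ p Y x′ y′ y →
           InSpanZ p Y x y z → InSpanZ p Y x′ y′ z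
  span-⊆ x∈ y∈ (cent c)    = cent c
  span-⊆ x∈ y∈ genx        = x∈
  span-⊆ x∈ y∈ geny        = y∈
  span-⊆ x∈ y∈ (mul u∈ w∈) = mul (span-⊆ x∈ y∈ u∈) (span-⊆ x∈ y∈ w∈)
  span-⊆ x∈ y∈ (inv u∈)    = inv (span-⊆ x∈ y∈ u∈)
  span-⊆ x∈ y∈ (resp r u∈) = resp r (span-⊆ x∈ y∈ u∈)

  sameSpan : ∀ {x y x′ y′} → InSpanZ p Y x′ y′ x → InSpanZ p Y x′ y′ y →
             InSpanZ p Y x y x′ → InSpanZ p Y x y y′ → SameSpan p Y x y x′ y′
  sameSpan x∈ y∈ x′∈ y′∈ _ = span-⊆ x∈ y∈ , span-⊆ x′∈ y′∈

  sameSpan-trans : ∀ {x y x′ y′ x″ y″} → SameSpan p Y x y x′ y′ → SameSpan p Y x′ y′ x″ y″ →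
                   SameSpan p Y x y x″ y″
  sameSpan-trans s s′ z = proj₁ (s′ z) ∘ proj₁ (s z) , proj₂ (s z) ∘ proj₂ (s′ z)

module HomomorphismProperties {p : ℕ} {X Y : Set} (g : Hom p X Y) where

  private module X = WordGroup p (LRel X)
  open WordGroup p (LRel Y)
  open Spans

  hom-e : fun g e ≈ e
  hom-e = identityʳ-unique (fun g e) (fun g e) (≈trans (≈sym (fun-hom g e e)) (fun-cong g (idˡ e)))

  hom-⁻¹ : ∀ x → fun g (x ⁻¹) ≈ fun g x ⁻¹
  hom-⁻¹ x = inverseʳ-unique (fun g x) (fun g (x ⁻¹))
    (≈trans (≈sym (fun-hom g x (x ⁻¹))) (≈trans (fun-cong g (invʳ x)) hom-e))

  hom-[,] : ∀ x y → fun g [ x , y ] ≈ [ fun g x , fun g y ]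
  hom-[,] x y = ≈trans (fun-hom g _ _)
    (∙-cong (≈trans (fun-hom g _ _) (∙-cong (hom-⁻¹ x) (hom-⁻¹ y))) (fun-hom g x y))

  images-commute : ∀ v → fun g (gen (a v)) ∙ fun g (gen (b v)) ≈ fun g (gen (b v)) ∙ fun g (gen (a v))
  images-commute v = [,]≈e⇒commute (≈trans (≈sym (hom-[,] _ _)) (≈trans (fun-cong g (rel (v , refl))) hom-e))

  module _ (surjective : SurjectiveH g) where

    central-image : ∀ {z} → X.IsCentral z → IsCentral (fun g z)
    central-image {z} z-central w with surjective w
    ... | s , gs≈w = begin
      fun g z ∙ w        ≈⟨ ∙-congˡ gs≈w ⟨
      fun g z ∙ fun g s  ≈⟨ fun-hom g z s ⟨
      fun g (z ∙ s)      ≈⟨ fun-cong g (z-central s) ⟩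
      fun g (s ∙ z)      ≈⟨ fun-hom g s z ⟩
      fun g s ∙ fun g z  ≈⟨ ∙-congʳ gs≈w ⟩
      w ∙ fun g z        ∎
      where open SetoidReasoning setoid

    span-image : ∀ {x y z} → InSpanZ p X x y z → InSpanZ p Y (fun g x) (fun g y) (fun g z)
    span-image (cent c)    = cent (central-image c)
    span-image genx        = genx
    span-image geny        = geny
    span-image (mul u∈ w∈) = resp (≈sym (fun-hom g _ _)) (mul (span-image u∈) (span-image w∈))
    span-image (inv u∈)    = resp (≈sym (hom-⁻¹ _)) (inv (span-image u∈))
    span-image (resp r u∈) = resp (fun-cong g r) (span-image u∈)

    sameSpan-image : ∀ {x y x′ y′} → SameSpan p X x y x′ y′ →
                     SameSpan p Y (fun g x) (fun g y) (fun g x′) (fun g y′)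
    sameSpan-image s = sameSpan (span-image (proj₁ (s _) genx)) (span-image (proj₁ (s _) geny))
                                (span-image (proj₂ (s _) genx)) (span-image (proj₂ (s _) geny))

module Coordinates {p : ℕ} (p-prime : Prime p) (p≢2 : p ≢ 2) {Y : Set} (enum : Y ↔ ℕ) where

  open Modular p
  open PrimeField p-prime
  open WordGroup p (LRel Y)
  open Spans
  open Heisenberg p (proj₁ (half p≢2)) (proj₂ (half p≢2))
  open Inverse enum using (to; from; strictlyInverseˡ; strictlyInverseʳ)

  W : Set
  W = Word (Gen Y)

  _≟_ : DecidableEquality Y
  _≟_ = ℕ.eq? (↔⇒↣ enum)

  _≟ᴳ_ : DecidableEquality (Gen Y)
  a y ≟ᴳ a y′ = Dec.map′ (cong a) (λ { refl → refl }) (y ≟ y′)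
  b y ≟ᴳ b y′ = Dec.map′ (cong b) (λ { refl → refl }) (y ≟ y′)
  a y ≟ᴳ b y′ = no λ ()
  b y ≟ᴳ a y′ = no λ ()

  base : Gen Y → Y
  base (a y) = y
  base (b y) = y

  partner : Gen Y → Gen Y
  partner (a y) = b y
  partner (b y) = a y

  base-partner : ∀ g → base (partner g) ≡ base g
  base-partner (a y) = refl
  base-partner (b y) = refl

  partner-≢ : ∀ g → g ≢ partner g
  partner-≢ (a y) ()
  partner-≢ (b y) ()

  another : ∀ y → ∃ λ y′ → y′ ≢ y
  another y with y ≟ from 0
  ... | no y≢y₀  = from 0 , y≢y₀ ∘ sym
  ... | yes refl = from 1 , λ y₁≡y₀ → ℕ.1+n≢0 (begin
    1              ≡⟨ strictlyInverseˡ 1 ⟨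
    to (from 1)    ≡⟨ cong to y₁≡y₀ ⟩
    to (from 0)    ≡⟨ strictlyInverseˡ 0 ⟩
    0              ∎)
    where open ≡-Reasoning

  δ : Gen Y → Gen Y → ℕ
  δ g x with g ≟ᴳ x
  ... | yes _ = 1
  ... | no  _ = 0

  δ-refl : ∀ g → δ g g ≡ 1
  δ-refl g with g ≟ᴳ g
  ... | yes _   = refl
  ... | no  g≢g = ⊥-elim (g≢g refl)

  δ-≢ : ∀ {g x} → g ≢ x → δ g x ≡ 0
  δ-≢ {g} {x} g≢x with g ≟ᴳ x
  ... | yes g≡x = ⊥-elim (g≢x g≡x)
  ... | no  _   = refl

  δ*δ≡0 : ∀ {g x g′ x′} → ¬ (g ≡ x × g′ ≡ x′) → + δ g x * + δ g′ x′ ≡ 0ℤ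
  δ*δ≡0 {g} {x} {g′} {x′} ¬both with g ≟ᴳ x | g′ ≟ᴳ x′
  ... | no _    | _         = refl
  ... | yes _   | no _      = refl
  ... | yes g≡x | yes g′≡x′ = ⊥-elim (¬both (g≡x , g′≡x′))

  coord : Gen Y → W → ℤ
  coord g = exponentSum (λ x → + δ g x)

  minor : Gen Y → Gen Y → W → W → ℤ
  minor g g′ s t = coord g s * coord g′ t - coord g′ s * coord g t

  det : Y → W → W → ℤ
  det y = minor (a y) (b y)

  coord-gen : ∀ g → coord g (gen g) ≡ 1ℤ
  coord-gen g = cong +_ (δ-refl g)

  coord-gen-≢ : ∀ {g x} → g ≢ x → coord g (gen x) ≡ 0ℤ
  coord-gen-≢ g≢x = cong +_ (δ-≢ g≢x)

  coord-a-gen-b : ∀ y y′ → coord (a y) (gen (b y′)) ≡ 0ℤ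
  coord-a-gen-b y y′ = coord-gen-≢ {a y} {b y′} λ ()

  coord-b-gen-a : ∀ y y′ → coord (b y) (gen (a y′)) ≡ 0ℤ
  coord-b-gen-a y y′ = coord-gen-≢ {b y} {a y′} λ ()

  pairing : Gen Y → Gen Y → Gen Y → H
  pairing g g′ x = ⟨ + δ g x , + δ g′ x , 0ℤ ⟩

  pairing-kills-relators : ∀ {g g′} → g′ ≢ partner g → ∀ {r} → LRel Y r →
                           Evaluation.⟦_⟧ (pairing g g′) r ≋ᴴ εᴴ
  pairing-kills-relators {g} {g′} g′≢ (v , refl) =
    ≋ᴴ-trans ([,]ᴴ≋ω (pairing g g′ (a v)) (pairing g g′ (b v)))
             (exactly refl refl (cong₂ _-_ (δ*δ≡0 {g} {a v} {g′} {b v} λ { (refl , refl) → g′≢ refl })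
                                           (δ*δ≡0 {g′} {a v} {g} {b v} λ { (refl , refl) → g′≢ refl })))

  coord-cong : ∀ g {s t} → s ≈ t → coord g s ≋ coord g t
  coord-cong g {s} {t} s≈t =
    subst₂ _≋_ (h₁-⟦⟧ s) (h₁-⟦⟧ t) (≋₁ (⟦⟧-cong (pairing-kills-relators (partner-≢ g)) s≈t))
    where open Evaluation (pairing g g)

  commute⇒minor≋0 : ∀ {g g′} → g′ ≢ partner g → ∀ {s t} → s ∙ t ≈ t ∙ s → minor g g′ s t ≋ 0ℤ
  commute⇒minor≋0 {g} {g′} g′≢ {s} {t} st≈ts =
    subst (_≋ 0ℤ) ω≡minor (commute⇒ω⟦⟧≋0 (pairing-kills-relators g′≢) st≈ts)
    where
    open Evaluation (pairing g g′)
    ω≡minor : ω ⟦ s ⟧ ⟦ t ⟧ ≡ minor g g′ s t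
    ω≡minor = cong₂ _-_ (cong₂ _*_ (h₁-⟦⟧ s) (h₂-⟦⟧ t)) (cong₂ _*_ (h₂-⟦⟧ s) (h₁-⟦⟧ t))

  central⇒coord≋0 : ∀ {z} → IsCentral z → ∀ g → coord g z ≋ 0ℤ
  central⇒coord≋0 {z} z-central g with another (base g)
  ... | y′ , y′≢ = subst (_≋ 0ℤ) minor≡coord (commute⇒minor≋0 a-y′≢partner (z-central (gen (a y′))))
    where
    a-y′≢partner : a y′ ≢ partner g
    a-y′≢partner eq = y′≢ (trans (cong base eq) (base-partner g))
    minor≡coord : minor g (a y′) z (gen (a y′)) ≡ coord g z
    minor≡coord = trans (cong₂ (λ u v → coord g z * u - coord (a y′) z * v)
                               (coord-gen (a y′)) (coord-gen-≢ (y′≢ ∘ sym ∘ cong base)))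
                        (simplify (coord g z) (coord (a y′) z))
      where simplify : ∀ c d → c * 1ℤ - d * 0ℤ ≡ c
            simplify = solve-∀

  -- Normal form modulo the centre

  index : Gen Y → ℕ
  index g = to (base g)

  bound : W → ℕ
  bound (gen x) = ℕ.suc (index x)
  bound e       = 0
  bound (s ∙ t) = bound s ℕ.⊔ bound t
  bound (s ⁻¹)  = bound s

  coord-beyond-bound : ∀ g z → bound z ℕ.≤ index g → coord g z ≡ 0ℤ
  coord-beyond-bound g (gen x) x<g = cong +_ (δ-≢ λ { refl → ℕ.<-irrefl refl x<g })
  coord-beyond-bound g e       _   = refl
  coord-beyond-bound g (s ∙ t) st≤g =
    cong₂ _+_ (coord-beyond-bound g s (ℕ.m⊔n≤o⇒m≤o (bound s) _ st≤g))
              (coord-beyond-bound g t (ℕ.m⊔n≤o⇒n≤o _ (bound t) st≤g))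
  coord-beyond-bound g (s ⁻¹)  s≤g = cong -_ (coord-beyond-bound g s s≤g)

  -- Exponent sums in ℕ: an inverse counts p - 1 ≡ -1 times.
  exponent : Gen Y → W → ℕ
  exponent g (gen x) = δ g x
  exponent g e       = 0
  exponent g (s ∙ t) = exponent g s ℕ.+ exponent g t
  exponent g (s ⁻¹)  = ℕ.pred p ℕ.* exponent g s

  exponent≋coord : ∀ g z → + exponent g z ≋ coord g z
  exponent≋coord g (gen x) = ≋-refl
  exponent≋coord g e       = ≋-refl
  exponent≋coord g (s ∙ t) = ≋-trans (≡⇒≋ (ℤ.pos-+ (exponent g s) (exponent g t)))
                                     (+-cong (exponent≋coord g s) (exponent≋coord g t))
  exponent≋coord g (s ⁻¹)  =
    ≋-trans (≡⇒≋ (ℤ.pos-* (ℕ.pred p) (exponent g s)))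
            (≋-trans (*-cong pred-p≋-1 (exponent≋coord g s)) (≡⇒≋ (ℤ.-1*i≡-i (coord g s))))

  block : ℕ → (Gen Y → ℕ) → W
  block k c = gen (a (from k)) ^ c (a (from k)) ∙ gen (b (from k)) ^ c (b (from k))

  monomial : ℕ → (Gen Y → ℕ) → W
  monomial ℕ.zero    c = e
  monomial (ℕ.suc n) c = monomial n c ∙ block n c

  private
    open CommutativeSemigroupProperties (AbelianGroup.commutativeSemigroup centralQuotient)
      using (interchange)
    module ~ = GroupProperties (AbelianGroup.group centralQuotient)

  monomial-+ : ∀ n c d → monomial n (λ g → c g ℕ.+ d g) ~ monomial n c ∙ monomial n d
  monomial-+ ℕ.zero    c d = ≈⇒~ (≈sym (idˡ e))
  monomial-+ (ℕ.suc n) c d = ~-trans (∙-cong~ (monomial-+ n c d) block-+) (interchange _ _ _ _)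
    where
    block-+ : block n (λ g → c g ℕ.+ d g) ~ block n c ∙ block n d
    block-+ = ~-trans (≈⇒~ (∙-cong (^-+ _ _ _) (^-+ _ _ _))) (interchange _ _ _ _)

  monomial≈e : ∀ n c → (∀ g → p ℕ.∣ c g) → monomial n c ≈ e
  monomial≈e ℕ.zero    c p∣c = ≈refl
  monomial≈e (ℕ.suc n) c p∣c =
    ≈trans (∙-cong (monomial≈e n c p∣c) block≈e′) (idˡ e)
    where
    block≈e′ : block n c ≈ e
    block≈e′ = ≈trans (∙-cong (∣⇒^≈e _ (p∣c _)) (∣⇒^≈e _ (p∣c _))) (idˡ e)

  monomial-⁻¹ : ∀ n c → monomial n (λ g → ℕ.pred p ℕ.* c g) ~ monomial n c ⁻¹
  monomial-⁻¹ n c = ~.inverseʳ-unique (monomial n c) _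
    (~-trans (~-sym (monomial-+ n c _)) (≈⇒~ (monomial≈e n _ p∣c+pred-p*c)))
    where
    p∣c+pred-p*c : ∀ g → p ℕ.∣ c g ℕ.+ ℕ.pred p ℕ.* c g
    p∣c+pred-p*c g = subst (λ q → p ℕ.∣ q ℕ.* c g) (sym (ℕ.suc-pred p)) (ℕ.m∣m*n (c g))

  block≈e : ∀ k c → c (a (from k)) ≡ 0 → c (b (from k)) ≡ 0 → block k c ≈ e
  block≈e k c ca≡0 cb≡0 rewrite ca≡0 | cb≡0 = idˡ e

  block-δ-≢ : ∀ k x → k ≢ index x → block k (λ g → δ g x) ≈ e
  block-δ-≢ k x k≢x = block≈e k (λ g → δ g x) (δ-≢ {a (from k)} (k≢index ∘ cong index))
                                                (δ-≢ {b (from k)} (k≢index ∘ cong index))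
    where
    k≢index : to (from k) ≢ index x
    k≢index = k≢x ∘ trans (sym (strictlyInverseˡ k))

  block-δ-index : ∀ x → block (index x) (λ g → δ g x) ≈ gen x
  block-δ-index (a y) rewrite strictlyInverseʳ y | δ-refl (a y) | δ-≢ {b y} {a y} (λ ()) =
    ≈trans (idʳ _) (idʳ _)
  block-δ-index (b y) rewrite strictlyInverseʳ y | δ-refl (b y) | δ-≢ {a y} {b y} (λ ()) =
    ≈trans (idˡ _) (idʳ _)

  monomial-δ-below : ∀ n x → n ℕ.≤ index x → monomial n (λ g → δ g x) ≈ e
  monomial-δ-below ℕ.zero    x _   = ≈refl
  monomial-δ-below (ℕ.suc n) x n<x =
    ≈trans (∙-cong (monomial-δ-below n x (ℕ.<⇒≤ n<x)) (block-δ-≢ n x (ℕ.<⇒≢ n<x))) (idˡ e)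

  monomial-δ : ∀ n x → index x ℕ.< n → monomial n (λ g → δ g x) ≈ gen x
  monomial-δ (ℕ.suc n) x (ℕ.s≤s x≤n) with ℕ.m≤n⇒m<n∨m≡n x≤n
  ... | inj₁ x<n  = ≈trans (∙-cong (monomial-δ n x x<n) (block-δ-≢ n x (ℕ.<⇒≢ x<n ∘ sym))) (idʳ (gen x))
  ... | inj₂ refl = ≈trans (∙-cong (monomial-δ-below n x ℕ.≤-refl) (block-δ-index x)) (idˡ (gen x))

  normalForm : ∀ n z → bound z ℕ.≤ n → z ~ monomial n (λ g → exponent g z)
  normalForm n (gen x) x<n  = ≈⇒~ (≈sym (monomial-δ n x x<n))
  normalForm n e       _    = ≈⇒~ (≈sym (monomial≈e n _ (λ _ → p ℕ.∣0)))
  normalForm n (s ∙ t) st≤n =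
    ~-trans (∙-cong~ (normalForm n s (ℕ.m⊔n≤o⇒m≤o (bound s) _ st≤n))
                     (normalForm n t (ℕ.m⊔n≤o⇒n≤o _ (bound t) st≤n)))
            (~-sym (monomial-+ n _ _))
  normalForm n (s ⁻¹)  s≤n  = ~-trans (⁻¹-cong~ (normalForm n s s≤n)) (~-sym (monomial-⁻¹ n _))

  coord≋0⇒central : ∀ {z} → (∀ g → coord g z ≋ 0ℤ) → IsCentral z
  coord≋0⇒central {z} coords≋0 = central-resp (≈trans (∙-congˡ ε⁻¹≈ε) (idʳ z)) z~e
    where
    p∣exponent : ∀ g → p ℕ.∣ exponent g z
    p∣exponent g = +≋0⇒∣ (≋-trans (exponent≋coord g z) (coords≋0 g))
    z~e : z ~ e
    z~e = ~-trans (normalForm (bound z) z ℕ.≤-refl) (≈⇒~ (monomial≈e (bound z) _ p∣exponent))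

  -- Spans as linear combinations of coordinate vectors

  coord-^∙^ : ∀ g x y m n → coord g (x ^ m ∙ y ^ n) ≡ + m * coord g x + + n * coord g y
  coord-^∙^ g x y m n = cong₂ _+_ (exponentSum-^ _ x m) (exponentSum-^ _ y n)

  coord-residue-^∙^ : ∀ g x y i j → coord g (x ^ residue i ∙ y ^ residue j) ≋ i * coord g x + j * coord g y
  coord-residue-^∙^ g x y i j = ≋-trans (≡⇒≋ (coord-^∙^ g x y (residue i) (residue j)))
    (+-cong (*-cong (+residue≋ i) ≋-refl) (*-cong (+residue≋ j) ≋-refl))

  Combination : ℤ → ℤ → W → W → W → Set
  Combination i j x y z = ∀ g → coord g z ≋ i * coord g x + j * coord g y

  span⇒combination : ∀ {x y z} → InSpanZ p Y x y z → ∃₂ λ i j → Combination i j x y z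
  span⇒combination (cent z-central) = 0ℤ , 0ℤ , central⇒coord≋0 z-central
  span⇒combination {x} {y} genx = 1ℤ , 0ℤ , λ g → ≡⇒≋ (unitˡ (coord g x) (coord g y))
    where unitˡ : ∀ u v → u ≡ 1ℤ * u + 0ℤ * v
          unitˡ = solve-∀
  span⇒combination {x} {y} geny = 0ℤ , 1ℤ , λ g → ≡⇒≋ (unitʳ (coord g x) (coord g y))
    where unitʳ : ∀ u v → v ≡ 0ℤ * u + 1ℤ * v
          unitʳ = solve-∀
  span⇒combination {x} {y} (mul u∈ w∈) with span⇒combination u∈ | span⇒combination w∈
  ... | i , j , u≋ | i′ , j′ , w≋ =
    i + i′ , j + j′ , λ g → ≋-trans (+-cong (u≋ g) (w≋ g)) (≡⇒≋ (collect i j i′ j′ (coord g x) (coord g y)))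
    where collect : ∀ i j i′ j′ u v → i * u + j * v + (i′ * u + j′ * v) ≡ (i + i′) * u + (j + j′) * v
          collect = solve-∀
  span⇒combination {x} {y} (inv u∈) with span⇒combination u∈
  ... | i , j , u≋ = - i , - j , λ g → ≋-trans (-‿cong (u≋ g)) (≡⇒≋ (negate i j (coord g x) (coord g y)))
    where negate : ∀ i j u v → - (i * u + j * v) ≡ - i * u + - j * v
          negate = solve-∀
  span⇒combination (resp u≈w u∈) with span⇒combination u∈
  ... | i , j , u≋ = i , j , λ g → ≋-trans (≋-sym (coord-cong g u≈w)) (u≋ g)

  combination⇒span : ∀ {i j x y z} → Combination i j x y z → InSpanZ p Y x y z
  combination⇒span {i} {j} {x} {y} {z} z≋ =
    resp (//-rightDividesˡ m z) (mul (cent remainder-central) (mul (span-^ _ genx) (span-^ _ geny)))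
    where
    m : W
    m = x ^ residue i ∙ y ^ residue j
    remainder-central : IsCentral (z ∙ m ⁻¹)
    remainder-central = coord≋0⇒central λ g →
      ≋-trans (+-cong (z≋ g) (-‿cong (coord-residue-^∙^ g x y i j)))
              (≡⇒≋ (ℤ.+-inverseʳ (i * coord g x + j * coord g y)))

  LinearlyIndependent : W → W → Set
  LinearlyIndependent x y = ∀ i j → (∀ g → i * coord g x + j * coord g y ≋ 0ℤ) → i ≋ 0ℤ × j ≋ 0ℤ

  rankTwo⇒independent : ∀ {x y} → RankTwo p Y x y → LinearlyIndependent x y
  rankTwo⇒independent {x} {y} rank i j vanish = reduce i (proj₁ p∣ij) , reduce j (proj₂ p∣ij)
    where
    p∣ij = rank (residue i) (residue j) (coord≋0⇒central λ g → ≋-trans (coord-residue-^∙^ g x y i j) (vanish g))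
    reduce : ∀ k → p ℕ.∣ residue k → k ≋ 0ℤ
    reduce k p∣k = ≋-trans (≋-sym (+residue≋ k)) (∣⇒+≋0 p∣k)

  independent⇒rankTwo : ∀ {x y} → LinearlyIndependent x y → RankTwo p Y x y
  independent⇒rankTwo {x} {y} independent m n central =
    Product.map +≋0⇒∣ +≋0⇒∣ (independent (+ m) (+ n) λ g →
      subst (_≋ 0ℤ) (coord-^∙^ g x y m n) (central⇒coord≋0 central g))

  det≉0⇒independent : ∀ {y s t} → det y s t ≉ 0ℤ → LinearlyIndependent s t
  det≉0⇒independent {y} det≉0 i j vanish = cramer det≉0 (vanish (a y)) (vanish (b y))

  generators∈span⇒det≉0 : ∀ {y s t} → InSpanZ p Y s t (gen (a y)) → InSpanZ p Y s t (gen (b y)) →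
                          det y s t ≉ 0ℤ
  generators∈span⇒det≉0 {y} {s} {t} a∈ b∈ det≋0 with span⇒combination a∈ | span⇒combination b∈
  ... | i , j , a≋ | k , l , b≋ = 1≉0 (begin
    1ℤ                                        ≡⟨⟩
    1ℤ * 1ℤ - 0ℤ * 0ℤ                         ≈⟨ +-cong (*-cong aa ab) (-‿cong (*-cong ba bb)) ⟩
    (i * sa + j * ta) * (k * sb + l * tb)
      - (i * sb + j * tb) * (k * sa + l * ta) ≡⟨ product i j k l sa sb ta tb ⟩
    (i * l - j * k) * det y s t               ≈⟨ *-cong (≋-refl {i * l - j * k}) det≋0 ⟩
    (i * l - j * k) * 0ℤ                      ≡⟨ ℤ.*-zeroʳ (i * l - j * k) ⟩
    0ℤ                                        ∎)
    where
    open ≋-Reasoning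
    sa = coord (a y) s
    sb = coord (b y) s
    ta = coord (a y) t
    tb = coord (b y) t
    aa : 1ℤ ≋ i * sa + j * ta
    aa = subst (_≋ i * sa + j * ta) (coord-gen (a y)) (a≋ (a y))
    ba : 0ℤ ≋ i * sb + j * tb
    ba = subst (_≋ i * sb + j * tb) (coord-b-gen-a y y) (a≋ (b y))
    ab : 1ℤ ≋ k * sb + l * tb
    ab = subst (_≋ k * sb + l * tb) (coord-gen (b y)) (b≋ (b y))
    bb : 0ℤ ≋ k * sa + l * ta
    bb = subst (_≋ k * sa + l * ta) (coord-a-gen-b y y) (b≋ (a y))
    product : ∀ i j k l sa sb ta tb →
      (i * sa + j * ta) * (k * sb + l * tb) - (i * sb + j * tb) * (k * sa + l * ta)
        ≡ (i * l - j * k) * (sa * tb - sb * ta)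
    product = solve-∀

  generators∈span⇒rankTwo : ∀ {y s t} → InSpanZ p Y s t (gen (a y)) → InSpanZ p Y s t (gen (b y)) →
                            RankTwo p Y s t
  generators∈span⇒rankTwo {y} {s} {t} a∈ b∈ =
    independent⇒rankTwo (det≉0⇒independent {y} {s} {t} (generators∈span⇒det≉0 a∈ b∈))

  generator∈span⇒≡ : ∀ {y y′} → InSpanZ p Y (gen (a y)) (gen (b y)) (gen (a y′)) → y′ ≡ y
  generator∈span⇒≡ {y} {y′} a′∈ with y′ ≟ y | span⇒combination a′∈
  ... | yes y′≡y | _           = y′≡y
  ... | no y′≢y  | i , j , a′≋ = ⊥-elim (1≉0 (begin
    1ℤ                          ≡⟨ coord-gen (a y′) ⟨
    coord (a y′) (gen (a y′))   ≈⟨ a′≋ (a y′) ⟩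
    i * c₁ + j * c₂             ≡⟨ cong₂ (λ u v → i * u + j * v) c₁≡0 (coord-a-gen-b y′ y) ⟩
    i * 0ℤ + j * 0ℤ             ≡⟨ *0+*0≡0 i j ⟩
    0ℤ                          ∎))
    where
    open ≋-Reasoning
    c₁ = coord (a y′) (gen (a y))
    c₂ = coord (a y′) (gen (b y))
    c₁≡0 : c₁ ≡ 0ℤ
    c₁≡0 = coord-gen-≢ (y′≢y ∘ cong base)

  -- Commuting pairs of rank two

  minors≋0⇒dependent : ∀ {x y} → (∀ g g′ → minor g g′ x y ≋ 0ℤ) → ¬ LinearlyIndependent x y
  minors≋0⇒dependent {x} {y} minors≋0 independent =
    1≉0 (proj₁ (independent 1ℤ 0ℤ λ g → ≋-trans (≡⇒≋ (unit (coord g x) (coord g y))) (coord-x≋0 g)))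
    where
    coords≋0 : ∀ g₀ → coord g₀ y ≋ 0ℤ × - coord g₀ x ≋ 0ℤ
    coords≋0 g₀ = independent (coord g₀ y) (- coord g₀ x) λ g →
      subst (_≋ 0ℤ) (rearrange (coord g x) (coord g₀ y) (coord g₀ x) (coord g y)) (minors≋0 g g₀)
      where rearrange : ∀ u v w z → u * v - w * z ≡ v * u + - w * z
            rearrange = solve-∀
    coord-x≋0 : ∀ g → coord g x ≋ 0ℤ
    coord-x≋0 g = ≋-trans (≡⇒≋ (sym (ℤ.neg-involutive (coord g x)))) (-‿cong (proj₂ (coords≋0 g)))
    unit : ∀ u v → 1ℤ * u + 0ℤ * v ≡ u
    unit = solve-∀

  commute-dets≋0⇒minors≋0 : ∀ {s t} → s ∙ t ≈ t ∙ s → (∀ y → det y s t ≋ 0ℤ) →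
                            ∀ g g′ → minor g g′ s t ≋ 0ℤ
  commute-dets≋0⇒minors≋0 {s} {t} st≈ts dets≋0 g g′ with g′ ≟ᴳ partner g
  ... | no g′≢ = commute⇒minor≋0 g′≢ st≈ts
  ... | yes refl = partner-minor g
    where
    partner-minor : ∀ g → minor g (partner g) s t ≋ 0ℤ
    partner-minor (a y) = dets≋0 y
    partner-minor (b y) =
      ≋-trans (≡⇒≋ (antisym (coord (a y) s) (coord (b y) s) (coord (a y) t) (coord (b y) t)))
              (-‿cong (dets≋0 y))
      where antisym : ∀ sa sb ta tb → sb * ta - sa * tb ≡ - (sa * tb - sb * ta)
            antisym = solve-∀

  det-beyond-bound : ∀ y s t → bound s ℕ.≤ to y → det y s t ≡ 0ℤ
  det-beyond-bound y s t s≤y = cong₂ (λ u v → u * coord (b y) t - v * coord (a y) t)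
                                     (coord-beyond-bound (a y) s s≤y) (coord-beyond-bound (b y) s s≤y)

  commute-independent⇒det≉0 : ∀ {s t} → s ∙ t ≈ t ∙ s → LinearlyIndependent s t → ∃ λ y → det y s t ≉ 0ℤ
  -- det y s t can only be non-zero for the finitely many y inside the support of s.
  commute-independent⇒det≉0 {s} {t} st≈ts independent
    with ℕ.anyUpTo? (λ k → Dec.¬? (det (from k) s t ≋? 0ℤ)) (bound s)
  ... | yes (k , _ , det≉0) = from k , det≉0
  ... | no ∄k = ⊥-elim (minors≋0⇒dependent {s} {t} (commute-dets≋0⇒minors≋0 st≈ts dets≋0) independent)
    where
    dets≋0 : ∀ y → det y s t ≋ 0ℤ
    dets≋0 y with to y ℕ.<? bound s
    ... | yes y<s = subst (λ y → det y s t ≋ 0ℤ) (strictlyInverseʳ y)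
                          (Dec.decidable-stable (det (from (to y)) s t ≋? 0ℤ) λ det≉0 → ∄k (to y , y<s , det≉0))
    ... | no  y≮s = ≡⇒≋ (det-beyond-bound y s t (ℕ.≮⇒≥ y≮s))

  Supported : Y → W → Set
  Supported y z = ∀ g → g ≢ a y → g ≢ b y → coord g z ≋ 0ℤ

  gen-a-supported : ∀ y → Supported y (gen (a y))
  gen-a-supported y g g≢a _ = ≡⇒≋ (coord-gen-≢ g≢a)

  gen-b-supported : ∀ y → Supported y (gen (b y))
  gen-b-supported y g _ g≢b = ≡⇒≋ (coord-gen-≢ g≢b)

  commute-det≉0⇒supported : ∀ {y s t} → s ∙ t ≈ t ∙ s → det y s t ≉ 0ℤ → Supported y s × Supported y t
  commute-det≉0⇒supported {y} {s} {t} st≈ts det≉0 =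
    (λ g g≢a g≢b → proj₁ (coords≋0 g g≢a g≢b)) , (λ g g≢a g≢b → proj₂ (coords≋0 g g≢a g≢b))
    where
    sa = coord (a y) s
    sb = coord (b y) s
    ta = coord (a y) t
    tb = coord (b y) t
    swap : ∀ u v w z → u * - v + w * z ≡ z * w - u * v
    swap = solve-∀
    coords≋0 : ∀ g → g ≢ a y → g ≢ b y → coord g s ≋ 0ℤ × coord g t ≋ 0ℤ
    coords≋0 g g≢a g≢b = cramer (det≉0 ∘ subst (_≋ 0ℤ) (swap′ sa sb ta tb))
      (subst (_≋ 0ℤ) (sym (swap (coord g s) ta (coord g t) sa)) (commute⇒minor≋0 g≢b st≈ts))
      (subst (_≋ 0ℤ) (sym (swap (coord g s) tb (coord g t) sb)) (commute⇒minor≋0 g≢a st≈ts))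
      where swap′ : ∀ sa sb ta tb → - ta * sb - - tb * sa ≡ sa * tb - sb * ta
            swap′ = solve-∀

  ∈span-by-support : ∀ y i j {s t z} → Supported y s → Supported y t → Supported y z →
    coord (a y) z ≋ i * coord (a y) s + j * coord (a y) t →
    coord (b y) z ≋ i * coord (b y) s + j * coord (b y) t → InSpanZ p Y s t z
  ∈span-by-support y i j {s} {t} {z} s-sup t-sup z-sup at-a at-b = combination⇒span {i} {j} z≋
    where
    z≋ : Combination i j s t z
    z≋ g with g ≟ᴳ a y | g ≟ᴳ b y
    ... | yes refl | _        = at-a
    ... | no _     | yes refl = at-b
    ... | no g≢a   | no g≢b   =
      ≋-trans (z-sup g g≢a g≢b) (≋-sym (lincomb-≋0 i j refl (s-sup g g≢a g≢b) (t-sup g g≢a g≢b)))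

  supported⇒∈span : ∀ {y z} → Supported y z → InSpanZ p Y (gen (a y)) (gen (b y)) z
  supported⇒∈span {y} {z} z-sup = ∈span-by-support y za zb (gen-a-supported y) (gen-b-supported y) z-sup
    (≡⇒≋ (sym (trans (cong₂ (λ u v → za * u + zb * v) (coord-gen (a y)) (coord-a-gen-b y y)) (first za zb))))
    (≡⇒≋ (sym (trans (cong₂ (λ u v → za * u + zb * v) (coord-b-gen-a y y) (coord-gen (b y))) (second za zb))))
    where
    za = coord (a y) z
    zb = coord (b y) z
    first : ∀ u v → u * 1ℤ + v * 0ℤ ≡ u
    first = solve-∀
    second : ∀ u v → u * 0ℤ + v * 1ℤ ≡ v
    second = solve-∀

  supported-det≉0⇒generators∈span : ∀ {y s t} → Supported y s → Supported y t → det y s t ≉ 0ℤ →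
                                    InSpanZ p Y s t (gen (a y)) × InSpanZ p Y s t (gen (b y))
  supported-det≉0⇒generators∈span {y} {s} {t} s-sup t-sup det≉0 with ≉0⇒invertible det≉0
  ... | d , det*d≋1 =
    ∈span-by-support y (d * tb) (- (d * sb)) s-sup t-sup (gen-a-supported y)
      (≋-trans (≡⇒≋ (coord-gen (a y))) (≋-trans (≋-sym det*d≋1) (≡⇒≋ (solveᵃᵃ d sa sb ta tb))))
      (≡⇒≋ (trans (coord-b-gen-a y y) (solveᵇᵃ d sb tb))) ,
    ∈span-by-support y (- (d * ta)) (d * sa) s-sup t-sup (gen-b-supported y)
      (≡⇒≋ (trans (coord-a-gen-b y y) (solveᵃᵇ d sa ta)))
      (≋-trans (≡⇒≋ (coord-gen (b y))) (≋-trans (≋-sym det*d≋1) (≡⇒≋ (solveᵇᵇ d sa sb ta tb))))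
    where
    sa = coord (a y) s
    sb = coord (b y) s
    ta = coord (a y) t
    tb = coord (b y) t
    solveᵃᵃ : ∀ d sa sb ta tb → (sa * tb - sb * ta) * d ≡ d * tb * sa + - (d * sb) * ta
    solveᵃᵃ = solve-∀
    solveᵇᵃ : ∀ d sb tb → 0ℤ ≡ d * tb * sb + - (d * sb) * tb
    solveᵇᵃ = solve-∀
    solveᵃᵇ : ∀ d sa ta → 0ℤ ≡ - (d * ta) * sa + d * sa * ta
    solveᵃᵇ = solve-∀
    solveᵇᵇ : ∀ d sa sb ta tb → (sa * tb - sb * ta) * d ≡ - (d * ta) * sb + d * sa * tb
    solveᵇᵇ = solve-∀

  sameSpan⇒rankTwo : ∀ {y s t} → SameSpan p Y s t (gen (a y)) (gen (b y)) → RankTwo p Y s t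
  sameSpan⇒rankTwo {y} same =
    generators∈span⇒rankTwo (proj₂ (same (gen (a y))) genx) (proj₂ (same (gen (b y))) geny)

  commute-det≉0⇒sameSpan : ∀ {y s t} → s ∙ t ≈ t ∙ s → det y s t ≉ 0ℤ →
                           SameSpan p Y s t (gen (a y)) (gen (b y))
  commute-det≉0⇒sameSpan st≈ts det≉0 =
    let s-sup , t-sup = commute-det≉0⇒supported st≈ts det≉0
        a∈ , b∈       = supported-det≉0⇒generators∈span s-sup t-sup det≉0
    in sameSpan (supported⇒∈span s-sup) (supported⇒∈span t-sup) a∈ b∈

  commute-independent⇒sameSpan : ∀ {s t} → s ∙ t ≈ t ∙ s → LinearlyIndependent s t →
                                 ∃ λ y → SameSpan p Y s t (gen (a y)) (gen (b y))
  commute-independent⇒sameSpan st≈ts independent =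
    Product.map₂ (commute-det≉0⇒sameSpan st≈ts) (commute-independent⇒det≉0 st≈ts independent)

mapGen-inverse : ∀ {X Y} {f : X → Y} {g : Y → X} → (∀ y → f (g y) ≡ y) → ∀ x → mapGen f (mapGen g x) ≡ x
mapGen-inverse f∘g≡id (a y) = cong a (f∘g≡id y)
mapGen-inverse f∘g≡id (b y) = cong b (f∘g≡id y)

mapWord-inverse : ∀ {G H} {f : G → H} {g : H → G} → (∀ x → f (g x) ≡ x) →
                  ∀ w → mapWord f (mapWord g w) ≡ w
mapWord-inverse f∘g≡id (gen x) = cong gen (f∘g≡id x)
mapWord-inverse f∘g≡id e       = refl
mapWord-inverse f∘g≡id (s ∙ t) = cong₂ _∙_ (mapWord-inverse f∘g≡id s) (mapWord-inverse f∘g≡id t)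
mapWord-inverse f∘g≡id (s ⁻¹)  = cong _⁻¹ (mapWord-inverse f∘g≡id s)

mapWord-^ : ∀ {G H} (f : G → H) x n → mapWord f (x ^ n) ≡ mapWord f x ^ n
mapWord-^ f x ℕ.zero    = refl
mapWord-^ f x (ℕ.suc n) = cong (mapWord f x ∙_) (mapWord-^ f x n)

module Relabelling {p : ℕ} {X Y : Set} (q : X → Y) where

  q̂-cong : ∀ {s t} → Rel p (LRel X) s t → Rel p (LRel Y) (mapWord (mapGen q) s) (mapWord (mapGen q) t)
  q̂-cong ≈refl            = ≈refl
  q̂-cong (≈sym r)         = ≈sym (q̂-cong r)
  q̂-cong (≈trans r r′)    = ≈trans (q̂-cong r) (q̂-cong r′)
  q̂-cong (∙-cong r r′)    = ∙-cong (q̂-cong r) (q̂-cong r′)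
  q̂-cong (⁻¹-cong r)      = ⁻¹-cong (q̂-cong r)
  q̂-cong (assoc x y z)    = assoc _ _ _
  q̂-cong (idˡ x)          = idˡ _
  q̂-cong (idʳ x)          = idʳ _
  q̂-cong (invˡ x)         = invˡ _
  q̂-cong (invʳ x)         = invʳ _
  q̂-cong (class2 x y z)   = class2 _ _ _
  q̂-cong (expo x)         = subst (λ w → Rel p (LRel Y) w e) (sym (mapWord-^ (mapGen q) x p)) (expo _)
  q̂-cong (rel (v , refl)) = rel (q v , refl)

  q̂ : Hom p X Y
  q̂ = qhatH p q q̂-cong

  q̂-surjective : Surjective q → SurjectiveH q̂
  q̂-surjective q-surjective w =
    mapWord (mapGen section) w ,
    Setoid.reflexive setoid (mapWord-inverse (mapGen-inverse (proj₂ ∘ q-surjective)) w)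
    where
    open WordGroup p (LRel Y) using (setoid)
    section : Y → X
    section = proj₁ ∘ q-surjective

∘H-surjective : ∀ {p X Y Z} {g : Hom p X Y} {h : Hom p Y Z} →
                SurjectiveH g → SurjectiveH h → SurjectiveH (h ∘H g)
∘H-surjective {h = h} g-surjective h-surjective w =
  let s , hs≈w = h-surjective w
      r , gr≈s = g-surjective s
  in r , ≈trans (fun-cong h gr≈s) hs≈w

module Functor {p : ℕ} (p-prime : Prime p) (p≢2 : p ≢ 2) where

  private
    module C (A : CInf) = Coordinates p-prime p≢2 (enum A)

  module _ (A B : CInf) (g : Hom p (Carrier A) (Carrier B)) (g-morphism : IsMorphism g) where

    -- F is only ever used through F-spec; keeping it abstract stops the conversion checker
    -- from unfolding the search that computes it.
    abstract
      private
        existence : ∀ v → ∃ λ y →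
          SameSpan p (Carrier B) (fun g (gen (a v))) (fun g (gen (b v))) (gen (a y)) (gen (b y))
        existence v = C.commute-independent⇒sameSpan B (HomomorphismProperties.images-commute g v)
                                                       (C.rankTwo⇒independent B (proj₂ g-morphism v))

      F : Carrier A → Carrier B
      F v = proj₁ (existence v)

      F-spec : Spec g F
      F-spec v = proj₂ (existence v)

    F-unique : (F′ : Carrier A → Carrier B) → Spec g F′ → ∀ v → F′ v ≡ F v
    F-unique F′ F′-spec v = C.generator∈span⇒≡ B (proj₁ (F-spec v _) (proj₂ (F′-spec v _) genx))

  module _ (A : CInf) where

    private
      identity = idH p (Carrier A)

    id-morphism : IsMorphism identity
    id-morphism = (λ w → w , ≈refl) , λ v → C.generators∈span⇒rankTwo A genx geny

    F-id : (id-morphism′ : IsMorphism identity) → ∀ v → F A A identity id-morphism′ v ≡ v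
    F-id id-morphism′ v = sym (F-unique A A identity id-morphism′ id (λ _ _ → id , id) v)

  module _ (A B C : CInf) (g : Hom p (Carrier A) (Carrier B)) (g-morphism : IsMorphism g)
           (h : Hom p (Carrier B) (Carrier C)) (h-morphism : IsMorphism h) where

    private
      ∘-spec : Spec (h ∘H g) (F B C h h-morphism ∘ F A B g g-morphism)
      ∘-spec v = Spans.sameSpan-trans
        (HomomorphismProperties.sameSpan-image h (proj₁ h-morphism) (F-spec A B g g-morphism v))
        (F-spec B C h h-morphism (F A B g g-morphism v))

    ∘-morphism : IsMorphism (h ∘H g)
    ∘-morphism = ∘H-surjective {g = g} {h = h} (proj₁ g-morphism) (proj₁ h-morphism) ,
                 λ v → C.sameSpan⇒rankTwo C (∘-spec v)

    F-∘ : (hg-morphism : IsMorphism (h ∘H g)) →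
          ∀ v → F A C (h ∘H g) hg-morphism v ≡ F B C h h-morphism (F A B g g-morphism v)
    F-∘ hg-morphism v =
      sym (F-unique A C (h ∘H g) hg-morphism (F B C h h-morphism ∘ F A B g g-morphism) ∘-spec v)

  module _ (A B : CInf) (q : Carrier A → Carrier B) (q-surjective : Surjective q) where

    open Relabelling {p} q

    q̂-morphism : IsMorphism q̂
    q̂-morphism = q̂-surjective q-surjective , λ v → C.generators∈span⇒rankTwo B genx geny

    F-q̂ : ∀ v → F A B q̂ q̂-morphism v ≡ q v
    F-q̂ v = sym (F-unique A B q̂ q̂-morphism q (λ _ _ → id , id) v)

lemma4p6 : (p : ℕ) → Prime p → p ≢ 2 →
    Σ ((A B : CInf) → (g : Hom p (Carrier A) (Carrier B)) → IsMorphism g → Carrier A → Carrier B) λ F →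
      ((A B : CInf) (g : Hom p (Carrier A) (Carrier B)) (mg : IsMorphism g) →
        Spec g (F A B g mg) × ((F' : Carrier A → Carrier B) → Spec g F' → ∀ v → F' v ≡ F A B g mg v))
      × ((A : CInf) → IsMorphism (idH p (Carrier A))
          × ((mid : IsMorphism (idH p (Carrier A))) → ∀ v → F A A (idH p (Carrier A)) mid v ≡ v))
      × ((A B C : CInf) (g : Hom p (Carrier A) (Carrier B)) (mg : IsMorphism g)
          (h : Hom p (Carrier B) (Carrier C)) (mh : IsMorphism h) →
          IsMorphism (h ∘H g)
          × ((mhg : IsMorphism (h ∘H g)) → ∀ v → F A C (h ∘H g) mhg v ≡ F B C h mh (F A B g mg v)))
      × ((A B : CInf) (q : Carrier A → Carrier B) → Surjective q →
          Σ (∀ {s t} → Rel p (LRel (Carrier A)) s t →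
                Rel p (LRel (Carrier B)) (mapWord (mapGen q) s) (mapWord (mapGen q) t)) λ cq →
            Σ (IsMorphism (qhatH p q cq)) λ mq → ∀ v → F A B (qhatH p q cq) mq v ≡ q v)
lemma4p6 p p-prime p≢2 =
    F
  , (λ A B g mg → F-spec A B g mg , F-unique A B g mg)
  , (λ A → id-morphism A , F-id A)
  , (λ A B C g mg h mh → ∘-morphism A B C g mg h mh , F-∘ A B C g mg h mh)
  , (λ A B q q-surjective → Relabelling.q̂-cong q , q̂-morphism A B q q-surjective , F-q̂ A B q q-surjective)
  where open Functor p-prime p≢2
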